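{- Any subgraph of the square grid, of the hexagonal grid, or of the octagonal-square grid has a unit-cube contact representation.
   Context: A unit-cube contact representation of a graph $G$ assigns to each vertex an axis-aligned unit cube in $\mathbb{R}^3$ such that the cubes have pairwise disjoint interiors, and two cubes share a boundary region of non-zero area if and only if the corresponding vertices are adjacent in $G$. The square grid, hexagonal grid and octagonal-square grid are the (finite portions of the) graphs of the planar tilings by squares, by regular hexagons, and by regular octagons and squares (the 4.8.8 tiling), respectively. -}

module Defs where

open import Data.Nat using (ℕ)
open import Data.Fin using (Fin; zero; suc)
open import Data.Bool using (Bool; true)
open import Data.Product using (Σ; ∃; _×_; _,_)
open import Data.Sum using (_⊎_)
open import Data.Empty using (⊥)
open import Data.Integer as ℤ using (ℤ; +_)
open import Data.Integer.Divisibility using () renaming (_∣_ to _∣ℤ_)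
open import Data.Rational using (ℚ; 0ℚ; 1ℚ; _+_; _-_; _≤_; _<_)
open import Relation.Binary.PropositionalEquality using (_≡_; _≢_)
open import Function.Bundles using (_⇔_)

Point : Set
Point = Fin 3 → ℚ

InClosedCube : Point → Point → Set
InClosedCube p x = ∀ k → (p k ≤ x k) × (x k ≤ p k + 1ℚ)

InOpenCube : Point → Point → Set
InOpenCube p x = ∀ k → (p k < x k) × (x k < p k + 1ℚ)

InteriorsDisjoint : Point → Point → Set
InteriorsDisjoint p q = ∀ (x : Point) → InOpenCube p x → InOpenCube q x → ⊥

-- The two closed cubes share a boundary region of non-zero area:
-- their intersection contains a non-degenerate (axis-parallel) square,
-- i.e. there are a centre x, a normal axis k and a half-width ε > 0 such
-- that every point y in the plane y k = x k with |y l - x l| ≤ ε (l ≠ k)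
-- lies in both closed cubes.
SharePositiveArea : Point → Point → Set
SharePositiveArea p q =
  Σ Point λ x → Σ (Fin 3) λ k → Σ ℚ λ ε → (0ℚ < ε) ×
    (∀ (y : Point) → y k ≡ x k →
       (∀ l → l ≢ k → (x l - ε ≤ y l) × (y l ≤ x l + ε)) →
       InClosedCube p y × InClosedCube q y)

Symm : {V : Set} → (V → V → Set) → V → V → Set
Symm R u v = R u v ⊎ R v u

SqStep : ℤ × ℤ → ℤ × ℤ → Set
SqStep (a , b) (c , d) = (c ≡ a ℤ.+ ℤ.1ℤ × d ≡ b) ⊎ (c ≡ a × d ≡ b ℤ.+ ℤ.1ℤ)

SquareAdj : ℤ × ℤ → ℤ × ℤ → Set
SquareAdj = Symm SqStep

-- hexagonal grid, in its standard "brick wall" model on ℤ²: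
-- all horizontal edges (a,b) ~ (a+1,b), and vertical edges
-- (a,b) ~ (a,b+1) exactly when a + b is even.
HexStep : ℤ × ℤ → ℤ × ℤ → Set
HexStep (a , b) (c , d) =
  (c ≡ a ℤ.+ ℤ.1ℤ × d ≡ b) ⊎ ((c ≡ a × d ≡ b ℤ.+ ℤ.1ℤ) × ((+ 2) ∣ℤ (a ℤ.+ b)))

HexAdj : ℤ × ℤ → ℤ × ℤ → Set
HexAdj = Symm HexStep

-- octagonal-square grid (4.8.8 tiling): one square per lattice cell
-- (a,b) ∈ ℤ², with corners 0 = east, 1 = north, 2 = west, 3 = south.
next4 : Fin 4 → Fin 4
next4 zero = suc zero
next4 (suc zero) = suc (suc zero)
next4 (suc (suc zero)) = suc (suc (suc zero))
next4 (suc (suc (suc zero))) = zero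

OctStep : ℤ × ℤ × Fin 4 → ℤ × ℤ × Fin 4 → Set
OctStep (a , b , i) (c , d , j) =
     (c ≡ a × d ≡ b × j ≡ next4 i)
  ⊎ (c ≡ a ℤ.+ ℤ.1ℤ × d ≡ b × i ≡ zero × j ≡ suc (suc zero))
  ⊎ (c ≡ a × d ≡ b ℤ.+ ℤ.1ℤ × i ≡ suc zero × j ≡ suc (suc (suc zero)))

OctSqAdj : ℤ × ℤ × Fin 4 → ℤ × ℤ × Fin 4 → Set
OctSqAdj = Symm OctStep

record FiniteSubgraph {V : Set} (Adj : V → V → Set) : Set where
  field
    n          : ℕ
    vertex     : Fin n → V
    vertex-inj : ∀ i j → vertex i ≡ vertex j → i ≡ j
    edge       : Fin n → Fin n → Bool
    edge-sym   : ∀ i j → edge i j ≡ edge j i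
    edge-adj   : ∀ i j → edge i j ≡ true → Adj (vertex i) (vertex j)

UnitCubeContactRep : (n : ℕ) → (Fin n → Fin n → Bool) → Set
UnitCubeContactRep n edge =
  Σ (Fin n → Point) λ pos →
    (∀ i j → i ≢ j → InteriorsDisjoint (pos i) (pos j)) ×
    (∀ i j → i ≢ j → (SharePositiveArea (pos i) (pos j) ⇔ (edge i j ≡ true)))

HasUnitCubeContactRep : {V : Set} {Adj : V → V → Set} → FiniteSubgraph Adj → Set
HasUnitCubeContactRep G = UnitCubeContactRep n edge
  where open FiniteSubgraph G

module Submission where

-- Let N = n², M = N + 2 and let the cubes have side U = 4M in
-- lattice units.  Vertex (a, b) gets the cube with lattice corner
--   (4M a − M b + h, 4M b + v, 3M (a + b)),
-- where the potentials h, v ∈ [0, N] count the missing grid edges before the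
-- vertex in its row, resp. column.  For a row neighbour the first coordinates
-- differ by exactly U when the edge is present and by U + 1 when it is missing,
-- while the other coordinates overlap by at least 2 (face contact, resp. strict
-- separation); column neighbours behave alike in the second coordinate.  For
-- every other pair some coordinate difference is c M + e with |c| ≥ 5 and
-- |e| < M, so the cubes are strictly apart (the third axis separates diagonal
-- neighbours).  The hexagonal grid is a subgraph of the square grid, and the
-- octagonal-square grid embeds into it by sending cell (a, b) to the unit square
-- at (2a + b, 2b − a); finite subgraphs transfer along these embeddings.

open import Defs
open import Data.Nat as ℕ using (ℕ; zero; suc)
import Data.Nat.Properties as ℕP
open import Data.Integer as ℤ using (ℤ; +_; -[1+_]; 0ℤ; 1ℤ; -1ℤ; ∣_∣)
import Data.Integer.Properties as ℤP
open import Data.Integer.Tactic.RingSolver using (solve-∀)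
open import Data.Rational as ℚ using (ℚ; 0ℚ; 1ℚ; toℚᵘ; fromℚᵘ)
import Data.Rational.Properties as ℚP
open import Data.Rational.Unnormalised as ℚᵘ using (mkℚᵘ; *≡*; *≤*; *<*)
import Data.Rational.Unnormalised.Properties as ℚᵘP
open import Data.Fin as Fin using (Fin; zero; suc)
import Data.Bool
open Data.Bool using (Bool; true; false)
open import Data.Product using (Σ; _×_; _,_; proj₁; proj₂)
import Data.Sum
open Data.Sum using (_⊎_; inj₁; inj₂)
open import Data.Empty using (⊥; ⊥-elim)
open import Relation.Nullary using (¬_; Dec; yes; no)
open import Relation.Binary.PropositionalEquality
  using (_≡_; _≢_; refl; sym; trans; cong; cong₂; subst; module ≡-Reasoning)
open import Function.Bundles using (_⇔_; mk⇔; Equivalence)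
open import Function.Base using (_∘_)
import Data.Fin.Properties as FinP
open import Algebra.Properties.CommutativeMonoid.Sum ℕP.+-0-commutativeMonoid
  using (sum; sum-remove; sum-cong-≗; sum-replicate-zero; ∑-distrib-+)

module IntegerFacts where
  open import Data.Integer using (_+_; _-_; _*_; -_; _≤_; _<_)

  ∣∣-≤ : ∀ {d k} → d ≤ + k → - d ≤ + k → ∣ d ∣ ℕ.≤ k
  ∣∣-≤ {d} d≤k -d≤k with ℤP.+∣i∣≡i⊎+∣i∣≡-i d
  ... | inj₁ eq = ℤP.drop‿+≤+ (subst (_≤ _) (sym eq) d≤k)
  ... | inj₂ eq = ℤP.drop‿+≤+ (subst (_≤ _) (sym eq) -d≤k)

  ∣∣-< : ∀ {d k} → d < + k → - d < + k → ∣ d ∣ ℕ.< k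
  ∣∣-< {d} d<k -d<k with ℤP.+∣i∣≡i⊎+∣i∣≡-i d
  ... | inj₁ eq = ℤP.drop‿+<+ (subst (_< _) (sym eq) d<k)
  ... | inj₂ eq = ℤP.drop‿+<+ (subst (_< _) (sym eq) -d<k)

  ∣i∣≤∣i+j∣+∣j∣ : ∀ i j → ∣ i ∣ ℕ.≤ ∣ i + j ∣ ℕ.+ ∣ j ∣
  ∣i∣≤∣i+j∣+∣j∣ i j = subst (λ z → ∣ z ∣ ℕ.≤ ∣ i + j ∣ ℕ.+ ∣ j ∣) (cancel i j) (ℤP.∣i-j∣≤∣i∣+∣j∣ (i + j) j)
    where
    cancel : ∀ i j → i + j - j ≡ i
    cancel = solve-∀

  add-sub : ∀ p k → p + k - p ≡ k
  add-sub = solve-∀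

  neg-diff : ∀ p q → - (q - p) ≡ p - q
  neg-diff = solve-∀

  ≤-diff : ∀ {p q k} → q ≤ p + k → q - p ≤ k
  ≤-diff {p} {q} {k} le = subst (q - p ≤_) (add-sub p k) (ℤP.+-monoˡ-≤ (- p) le)

  <-diff : ∀ {p q k} → q < p + k → q - p < k
  <-diff {p} {q} {k} lt = subst (q - p <_) (add-sub p k) (ℤP.+-monoˡ-< (- p) lt)

  ∣diff∣-≤ : ∀ {p q k} → q ≤ p + + k → p ≤ q + + k → ∣ q - p ∣ ℕ.≤ k
  ∣diff∣-≤ {p} {q} q≤ p≤ = ∣∣-≤ (≤-diff q≤) (subst (_≤ _) (sym (neg-diff p q)) (≤-diff p≤))

  ∣diff∣-< : ∀ {p q k} → q < p + + k → p < q + + k → ∣ q - p ∣ ℕ.< k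
  ∣diff∣-< {p} {q} q< p< = ∣∣-< (<-diff q<) (subst (_< _) (sym (neg-diff p q)) (<-diff p<))

  i-j≡k⇒i≡j+k : ∀ {i j k} → i - j ≡ k → i ≡ j + k
  i-j≡k⇒i≡j+k {i} {j} refl = split i j
    where
    split : ∀ i j → i ≡ j + (i - j)
    split = solve-∀

  shift-diff : ∀ {x x′ d} → x′ ≡ x + d → x′ - x ≡ d
  shift-diff {x} {d = d} refl = add-sub x d

  back-diff : ∀ {x x′} → x ≡ x′ + 1ℤ → x′ - x ≡ -1ℤ
  back-diff {x′ = x′} refl = cancel x′
    where
    cancel : ∀ x′ → x′ - (x′ + 1ℤ) ≡ -1ℤ
    cancel = solve-∀

  flip-diff : ∀ {x x′ d} → x′ - x ≡ d → x - x′ ≡ - d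
  flip-diff {x} {x′} refl = sym (neg-diff x x′)

open IntegerFacts

-- Unit cubes whose corners lie on the lattice (1/U)ℤ³: criteria, in terms of
-- integer corner differences, for disjoint interiors and for face contact.
module Geometry (u : ℕ) where
  open import Data.Integer using (_+_; _-_; _*_; -_; _≤_; _<_)

  U : ℕ
  U = suc u

  ι : ℤ → ℚ
  ι z = fromℚᵘ (mkℚᵘ z u)

  private
    toℚᵘ-ι : ∀ z → toℚᵘ (ι z) ℚᵘ.≃ mkℚᵘ z u
    toℚᵘ-ι z = ℚP.toℚᵘ-fromℚᵘ (mkℚᵘ z u)

  ι-cancel-≤ : ∀ {x y} → ι x ℚ.≤ ι y → x ≤ y
  ι-cancel-≤ {x} {y} le
    with ℚᵘP.≤-respˡ-≃ (toℚᵘ-ι x) (ℚᵘP.≤-respʳ-≃ (toℚᵘ-ι y) (ℚP.toℚᵘ-mono-≤ le))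
  ... | *≤* h = ℤP.*-cancelʳ-≤-pos x y (+ U) h

  ι-mono-≤ : ∀ {x y} → x ≤ y → ι x ℚ.≤ ι y
  ι-mono-≤ {x} {y} le = ℚP.toℚᵘ-cancel-≤
    (ℚᵘP.≤-respˡ-≃ (ℚᵘP.≃-sym (toℚᵘ-ι x)) (ℚᵘP.≤-respʳ-≃ (ℚᵘP.≃-sym (toℚᵘ-ι y))
      (*≤* (ℤP.*-monoʳ-≤-nonNeg (+ U) le))))

  ι-cancel-< : ∀ {x y} → ι x ℚ.< ι y → x < y
  ι-cancel-< {x} {y} lt
    with ℚᵘP.<-respˡ-≃ (toℚᵘ-ι x) (ℚᵘP.<-respʳ-≃ (toℚᵘ-ι y) (ℚP.toℚᵘ-mono-< lt))
  ... | *<* h = ℤP.*-cancelʳ-<-nonNeg (+ U) h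

  ι-mono-< : ∀ {x y} → x < y → ι x ℚ.< ι y
  ι-mono-< {x} {y} lt = ℚP.toℚᵘ-cancel-<
    (ℚᵘP.<-respˡ-≃ (ℚᵘP.≃-sym (toℚᵘ-ι x)) (ℚᵘP.<-respʳ-≃ (ℚᵘP.≃-sym (toℚᵘ-ι y))
      (*<* (ℤP.*-monoʳ-<-pos (+ U) lt))))

  ι-+ : ∀ x y → ι x ℚ.+ ι y ≡ ι (x + y)
  ι-+ x y = ℚP.toℚᵘ-injective (ℚᵘP.≃-trans (ℚP.toℚᵘ-homo-+ (ι x) (ι y))
    (ℚᵘP.≃-trans (ℚᵘP.+-cong (toℚᵘ-ι x) (toℚᵘ-ι y))
      (ℚᵘP.≃-trans (*≡* (trans (common x y (+ U)) (cong ((x + y) *_) (sym (ℤP.pos-* U U)))))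
        (ℚᵘP.≃-sym (toℚᵘ-ι (x + y))))))
    where
    common : ∀ x y V → (x * V + y * V) * V ≡ (x + y) * (V * V)
    common = solve-∀

  ι-neg : ∀ x → ℚ.- ι x ≡ ι (- x)
  ι-neg x = ℚP.toℚᵘ-injective (ℚᵘP.≃-trans (ℚP.toℚᵘ-homo‿- (ι x))
    (ℚᵘP.≃-trans (ℚᵘP.-‿cong (toℚᵘ-ι x)) (ℚᵘP.≃-sym (toℚᵘ-ι (- x)))))

  ι-- : ∀ x y → ι x ℚ.- ι y ≡ ι (x - y)
  ι-- x y = trans (cong (ι x ℚ.+_) (ι-neg y)) (ι-+ x (- y))

  ι-0 : 0ℚ ≡ ι 0ℤ
  ι-0 = ℚP.fromℚᵘ-cong {mkℚᵘ 0ℤ 0} {mkℚᵘ 0ℤ u} (*≡* refl)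

  ι-U : 1ℚ ≡ ι (+ U)
  ι-U = ℚP.fromℚᵘ-cong {mkℚᵘ 1ℤ 0} {mkℚᵘ (+ U) u} (*≡* (trans (ℤP.*-identityˡ (+ U)) (sym (ℤP.*-identityʳ (+ U)))))

  ι-top : ∀ z → ι z ℚ.+ 1ℚ ≡ ι (z + + U)
  ι-top z = trans (cong (ι z ℚ.+_) ι-U) (ι-+ z (+ U))

  pt : (Fin 3 → ℤ) → Point
  pt P k = ι (P k)

  reach-≤ : ∀ {p q t} → ι q ℚ.≤ t → t ℚ.≤ ι p ℚ.+ 1ℚ → q ≤ p + + U
  reach-≤ {p} q≤t t≤p+1 = ι-cancel-≤ (ℚP.≤-trans q≤t (subst (_ ℚ.≤_) (ι-top p) t≤p+1))

  reach-< : ∀ {p q t} → ι q ℚ.< t → t ℚ.< ι p ℚ.+ 1ℚ → q < p + + U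
  reach-< {p} q<t t<p+1 = ι-cancel-< (ℚP.<-trans q<t (subst (_ ℚ.<_) (ι-top p) t<p+1))

  closed-meet : ∀ {P Q x} → InClosedCube (pt P) x → InClosedCube (pt Q) x →
                ∀ l → ∣ Q l - P l ∣ ℕ.≤ U
  closed-meet {P} {Q} cp cq l =
    ∣diff∣-≤ {P l} {Q l}
      (reach-≤ {P l} {Q l} (proj₁ (cq l)) (proj₂ (cp l))) (reach-≤ {Q l} {P l} (proj₁ (cp l)) (proj₂ (cq l)))

  open-meet : ∀ {P Q x} → InOpenCube (pt P) x → InOpenCube (pt Q) x →
              ∀ l → ∣ Q l - P l ∣ ℕ.< U
  open-meet {P} {Q} op oq l =
    ∣diff∣-< {P l} {Q l}
      (reach-< {P l} {Q l} (proj₁ (oq l)) (proj₂ (op l))) (reach-< {Q l} {P l} (proj₁ (op l)) (proj₂ (oq l)))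

  disjoint : ∀ {P Q} l → U ℕ.≤ ∣ Q l - P l ∣ → InteriorsDisjoint (pt P) (pt Q)
  disjoint {P} {Q} l far x op oq = ℕP.<⇒≱ (open-meet {P} {Q} op oq l) far

  no-contact : ∀ {P Q} l → U ℕ.< ∣ Q l - P l ∣ → ¬ SharePositiveArea (pt P) (pt Q)
  no-contact {P} {Q} l far (x , k , ε , ε>0 , inside) = ℕP.<⇒≱ far (closed-meet {P} {Q} cp cq l)
    where
    ε≥0 : 0ℚ ℚ.≤ ε
    ε≥0 = ℚP.<⇒≤ ε>0
    centre : ∀ l → l ≢ k → (x l ℚ.- ε ℚ.≤ x l) × (x l ℚ.≤ x l ℚ.+ ε)
    centre l _ =
        subst (x l ℚ.- ε ℚ.≤_) (ℚP.+-identityʳ (x l)) (ℚP.+-monoʳ-≤ (x l) (ℚP.neg-antimono-≤ ε≥0))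
      , subst (ℚ._≤ x l ℚ.+ ε) (ℚP.+-identityʳ (x l)) (ℚP.+-monoʳ-≤ (x l) ε≥0)
    cp = proj₁ (inside x refl centre)
    cq = proj₂ (inside x refl centre)

  Covers : ℤ → ℤ → ℤ → ℤ → Set
  Covers p q lo hi = (p ≤ lo × q ≤ lo) × (hi ≤ p + + U × hi ≤ q + + U)

  covered : ∀ {p q lo hi t} → Covers p q lo hi → ι lo ℚ.≤ t → t ℚ.≤ ι hi →
            (ι p ℚ.≤ t × t ℚ.≤ ι p ℚ.+ 1ℚ) × (ι q ℚ.≤ t × t ℚ.≤ ι q ℚ.+ 1ℚ)
  covered {p} {q} {lo} {hi} {t} ((p≤ , q≤) , (≤p , ≤q)) lo≤t t≤hi =
      (ℚP.≤-trans (ι-mono-≤ p≤) lo≤t , below p ≤p)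
    , (ℚP.≤-trans (ι-mono-≤ q≤) lo≤t , below q ≤q)
    where
    below : ∀ a → hi ≤ a + + U → t ℚ.≤ ι a ℚ.+ 1ℚ
    below a hi≤ = ℚP.≤-trans t≤hi (subst (_ ℚ.≤_) (sym (ι-top a)) (ι-mono-≤ hi≤))

  share : ∀ P Q k (C : Fin 3 → ℤ) → Covers (P k) (Q k) (C k) (C k) →
          (∀ l → l ≢ k → Covers (P l) (Q l) (C l - 1ℤ) (C l + 1ℤ)) →
          SharePositiveArea (pt P) (pt Q)
  share P Q k C normal others =
    pt C , k , ι 1ℤ , subst (ℚ._< ι 1ℤ) (sym ι-0) (ι-mono-< {0ℤ} {1ℤ} (ℤ.+<+ (ℕ.s≤s ℕ.z≤n))) , inside
    where
    inside : ∀ y → y k ≡ ι (C k) →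
             (∀ l → l ≢ k → (ι (C l) ℚ.- ι 1ℤ ℚ.≤ y l) × (y l ℚ.≤ ι (C l) ℚ.+ ι 1ℤ)) →
             InClosedCube (pt P) y × InClosedCube (pt Q) y
    inside y yk near = (λ m → proj₁ (at m)) , (λ m → proj₂ (at m))
      where
      at : ∀ m → (ι (P m) ℚ.≤ y m × y m ℚ.≤ ι (P m) ℚ.+ 1ℚ) × (ι (Q m) ℚ.≤ y m × y m ℚ.≤ ι (Q m) ℚ.+ 1ℚ)
      at m with m Fin.≟ k
      ... | yes refl = covered normal (ℚP.≤-reflexive (sym yk)) (ℚP.≤-reflexive yk)
      ... | no m≢k = covered (others m m≢k)
                       (subst (ℚ._≤ y m) (ι-- (C m) 1ℤ) (proj₁ (near m m≢k)))
                       (subst (y m ℚ.≤_) (ι-+ (C m) 1ℤ) (proj₂ (near m m≢k)))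

  window-ordered : ∀ {p q} → p ≤ q → 2 ℕ.+ ∣ q - p ∣ ℕ.≤ U →
                   Σ ℤ λ c → Covers p q (c - 1ℤ) (c + 1ℤ)
  window-ordered {p} {q} p≤q wide =
    q + 1ℤ , (subst (p ≤_) (sym (lo-eq q)) p≤q , ℤP.≤-reflexive (sym (lo-eq q)))
           , (fits , subst (_≤ q + + U) (hi-eq q) (ℤP.+-monoʳ-≤ q (ℤ.+≤+ 2≤U)))
    where
    lo-eq : ∀ q → q + 1ℤ - 1ℤ ≡ q
    lo-eq = solve-∀
    hi-eq : ∀ q → q + + 2 ≡ q + 1ℤ + 1ℤ
    hi-eq = solve-∀
    2≤U : 2 ℕ.≤ U
    2≤U = ℕP.m+n≤o⇒m≤o 2 wide
    room : + 2 + (q - p) ≤ + U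
    room = subst (_≤ + U) (cong (λ d → + 2 + d) (ℤP.0≤i⇒+∣i∣≡i (ℤP.i≤j⇒0≤j-i p≤q))) (ℤ.+≤+ wide)
    shift : ∀ p q → p + (+ 2 + (q - p)) ≡ q + 1ℤ + 1ℤ
    shift = solve-∀
    fits : q + 1ℤ + 1ℤ ≤ p + + U
    fits = subst (_≤ p + + U) (shift p q) (ℤP.+-monoʳ-≤ p room)

  window : ∀ {p q} → 2 ℕ.+ ∣ q - p ∣ ℕ.≤ U → Σ ℤ λ c → Covers p q (c - 1ℤ) (c + 1ℤ)
  window {p} {q} wide with ℤP.≤-total p q
  ... | inj₁ p≤q = window-ordered p≤q wide
  ... | inj₂ q≤p with window-ordered q≤p (subst (λ d → 2 ℕ.+ d ℕ.≤ U) (ℤP.∣i-j∣≡∣j-i∣ q p) wide)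
  ...   | c , (q≤ , p≤) , (≤q , ≤p) = c , (p≤ , q≤) , (≤p , ≤q)

  contact : ∀ P Q k → Q k - P k ≡ + U → (∀ l → l ≢ k → 2 ℕ.+ ∣ Q l - P l ∣ ℕ.≤ U) →
            SharePositiveArea (pt P) (pt Q)
  contact P Q k touch wide = share P Q k C normal others
    where
    C : Fin 3 → ℤ
    C l with l Fin.≟ k
    ... | yes _ = Q k
    ... | no l≢k = proj₁ (window {P l} {Q l} (wide l l≢k))
    normal : Covers (P k) (Q k) (C k) (C k)
    normal with k Fin.≟ k
    ... | no k≢k = ⊥-elim (k≢k refl)
    ... | yes _ = (ℤP.≤-trans (ℤP.i≤i+j (P k) (+ U)) (ℤP.≤-reflexive (sym Q≡)) , ℤP.≤-refl)
                , (ℤP.≤-reflexive Q≡ , ℤP.i≤i+j (Q k) (+ U))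
      where
      Q≡ : Q k ≡ P k + + U
      Q≡ = i-j≡k⇒i≡j+k touch
    others : ∀ l → l ≢ k → Covers (P l) (Q l) (C l - 1ℤ) (C l + 1ℤ)
    others l l≢k with l Fin.≟ k
    ... | yes l≡k = ⊥-elim (l≢k l≡k)
    ... | no l≢k′ = proj₂ (window {P l} {Q l} (wide l l≢k′))

  GoodPair : (Fin 3 → ℤ) → (Fin 3 → ℤ) → Bool → Set
  GoodPair P Q e =
    InteriorsDisjoint (pt P) (pt Q) × (SharePositiveArea (pt P) (pt Q) ⇔ e ≡ true)

  good-apart : ∀ P Q {e} l → U ℕ.< ∣ Q l - P l ∣ → e ≡ false → GoodPair P Q e
  good-apart P Q l far e≡false =
      disjoint {P} {Q} l (ℕP.<⇒≤ far)
    , mk⇔ (λ sh → ⊥-elim (no-contact {P} {Q} l far sh)) (λ e≡true → ⊥-elim (absurd (trans (sym e≡true) e≡false)))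
    where
    absurd : true ≢ false
    absurd ()

  good-contact : ∀ P Q {e} k → Q k - P k ≡ + U →
                 (∀ l → l ≢ k → 2 ℕ.+ ∣ Q l - P l ∣ ℕ.≤ U) → e ≡ true → GoodPair P Q e
  good-contact P Q k touch wide e≡true =
      disjoint {P} {Q} k (ℕP.≤-reflexive (sym (cong ∣_∣ touch)))
    , mk⇔ (λ _ → e≡true) (λ _ → contact P Q k touch wide)

  good-mirror : ∀ P Q {e} → GoodPair Q P e → GoodPair P Q e
  good-mirror P Q (disj , iff) =
    (λ x op oq → disj x oq op) , mk⇔ (λ sh → Equivalence.to iff (swap sh)) (λ e → swap (Equivalence.from iff e))
    where
    swap : ∀ {p q} → SharePositiveArea p q → SharePositiveArea q p
    swap (x , k , ε , ε>0 , inside) =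
      x , k , ε , ε>0 , λ y yk near → proj₂ (inside y yk near) , proj₁ (inside y yk near)

module FiniteSums where

  𝟙 : ∀ {p} {P : Set p} → Dec P → ℕ
  𝟙 (yes _) = 1
  𝟙 (no _) = 0

  𝟙-yes : ∀ {p} {P : Set p} (d : Dec P) → P → ∀ m → 𝟙 d ℕ.* m ≡ m
  𝟙-yes (yes _) _ m = ℕP.+-identityʳ m
  𝟙-yes (no ¬p) p _ = ⊥-elim (¬p p)

  𝟙-no : ∀ {p} {P : Set p} (d : Dec P) → ¬ P → ∀ m → 𝟙 d ℕ.* m ≡ 0
  𝟙-no (yes p) ¬p _ = ⊥-elim (¬p p)
  𝟙-no (no _) _ _ = refl

  𝟙*-≤ : ∀ {p} {P : Set p} (d : Dec P) m → 𝟙 d ℕ.* m ℕ.≤ m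
  𝟙*-≤ (yes _) m = ℕP.≤-reflexive (ℕP.+-identityʳ m)
  𝟙*-≤ (no _) _ = ℕ.z≤n

  𝟙-split : ∀ {a b c} {A : Set a} {B : Set b} {C : Set c} (dA : Dec A) (dB : Dec B) (dC : Dec C) →
            (A → B ⊎ C) → (B → A) → (C → A) → (B → C → ⊥) → 𝟙 dA ≡ 𝟙 dB ℕ.+ 𝟙 dC
  𝟙-split (yes a) dB dC cases fromB fromC excl with cases a | dB | dC
  ... | _ | yes b | yes c = ⊥-elim (excl b c)
  ... | _ | yes _ | no _ = refl
  ... | _ | no _ | yes _ = refl
  ... | inj₁ b | no ¬b | no _ = ⊥-elim (¬b b)
  ... | inj₂ c | no _ | no ¬c = ⊥-elim (¬c c)
  𝟙-split (no ¬a) (yes b) dC cases fromB fromC excl = ⊥-elim (¬a (fromB b))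
  𝟙-split (no ¬a) (no _) (yes c) cases fromB fromC excl = ⊥-elim (¬a (fromC c))
  𝟙-split (no _) (no _) (no _) cases fromB fromC excl = refl

  sum-single : ∀ {n} (f : Fin n → ℕ) i → (∀ j → j ≢ i → f j ≡ 0) → sum f ≡ f i
  sum-single {suc n} f i vanish =
    trans (sum-remove {i = i} f) (trans (cong (f i ℕ.+_) rest) (ℕP.+-identityʳ (f i)))
    where
    rest : sum (λ j → f (Fin.punchIn i j)) ≡ 0
    rest = trans (sum-cong-≗ (λ j → vanish (Fin.punchIn i j) (FinP.punchInᵢ≢i i j)))
                 (sum-replicate-zero n)

  sum-select : ∀ {n p} {P : Fin n → Set p} (P? : ∀ j → Dec (P j)) (g : Fin n → ℕ) i →
               P i → (∀ j → P j → j ≡ i) → sum (λ j → 𝟙 (P? j) ℕ.* g j) ≡ g i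
  sum-select P? g i Pi unique =
    trans (sum-single _ i (λ j j≢i → 𝟙-no (P? j) (j≢i ∘ unique j) (g j))) (𝟙-yes (P? i) Pi (g i))

  sum-≤ : ∀ {n} (f : Fin n → ℕ) c → (∀ j → f j ℕ.≤ c) → sum f ℕ.≤ n ℕ.* c
  sum-≤ {zero} f c bound = ℕ.z≤n
  sum-≤ {suc n} f c bound = ℕP.+-mono-≤ (bound zero) (sum-≤ (f ∘ suc) c (bound ∘ suc))

open FiniteSums

module Potential {n : ℕ} (α β : Fin n → ℤ)
                 (injective : ∀ j k → α j ≡ α k → β j ≡ β k → j ≡ k)
                 (present : Fin n → Fin n → Bool) where
  open import Data.Integer using (_+_; _≤_; _<_)
  open import Relation.Nullary using (_×-dec_)

  Successor : Fin n → Fin n → Set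
  Successor j k = α k ≡ α j + 1ℤ × β k ≡ β j

  Before : Fin n → Fin n → Set
  Before j i = β j ≡ β i × α j < α i

  At : Fin n → Fin n → Set
  At j i = α j ≡ α i × β j ≡ β i

  successor? : ∀ j k → Dec (Successor j k)
  successor? j k = α k ℤ.≟ α j + 1ℤ ×-dec β k ℤ.≟ β j

  before? : ∀ j i → Dec (Before j i)
  before? j i = β j ℤ.≟ β i ×-dec α j ℤ.<? α i

  at? : ∀ j i → Dec (At j i)
  at? j i = α j ℤ.≟ α i ×-dec β j ℤ.≟ β i

  absent? : ∀ j k → Dec (present j k ≡ false)
  absent? j k = present j k Data.Bool.≟ false

  broken : Fin n → ℕ
  broken j = sum λ k → 𝟙 (successor? j k) ℕ.* 𝟙 (absent? j k)

  potential : Fin n → ℕ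
  potential i = sum λ j → 𝟙 (before? j i) ℕ.* broken j

  potential-≤ : ∀ i → potential i ℕ.≤ n ℕ.* n
  potential-≤ i = sum-≤ _ n λ j → ℕP.≤-trans (𝟙*-≤ (before? j i) (broken j))
    (subst (broken j ℕ.≤_) (ℕP.*-identityʳ n)
      (sum-≤ _ 1 λ k → ℕP.≤-trans (𝟙*-≤ (successor? j k) _) (𝟙≤1 (absent? j k))))
    where
    𝟙≤1 : ∀ {p} {P : Set p} (d : Dec P) → 𝟙 d ℕ.≤ 1
    𝟙≤1 (yes _) = ℕP.≤-refl
    𝟙≤1 (no _) = ℕ.z≤n

  broken-at : ∀ {i k} → Successor i k → broken i ≡ 𝟙 (absent? i k)
  broken-at {i} {k} succ = sum-select (successor? i) (λ k′ → 𝟙 (absent? i k′)) k succ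
    λ k′ (α≡ , β≡) → injective k′ k (trans α≡ (sym (proj₁ succ))) (trans β≡ (sym (proj₂ succ)))

  before-successor : ∀ {i k} → Successor i k → ∀ j →
                     𝟙 (before? j k) ≡ 𝟙 (before? j i) ℕ.+ 𝟙 (at? j i)
  before-successor {i} {k} (αk , βk) j =
    𝟙-split (before? j k) (before? j i) (at? j i) cases fromBefore fromAt exclusive
    where
    pred-eq : ∀ x → -1ℤ + (x + 1ℤ) ≡ x
    pred-eq = solve-∀
    cases : Before j k → Before j i ⊎ At j i
    cases (βj , αj<) with α j ℤ.≟ α i
    ... | yes αj≡ = inj₂ (αj≡ , trans βj βk)
    ... | no αj≢ = inj₁ (trans βj βk , ℤP.≤∧≢⇒< (subst (α j ≤_) (pred-eq (α i))
                                              (ℤP.i<j⇒i≤pred[j] (subst (α j <_) αk αj<))) αj≢)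
    below-succ : ∀ {x} → x ≤ α i → x < α k
    below-succ x≤ = subst (_ <_) (sym αk) (ℤP.i≤pred[j]⇒i<j (subst (_ ≤_) (sym (pred-eq (α i))) x≤))
    fromBefore : Before j i → Before j k
    fromBefore (βj , αj<) = trans βj (sym βk) , below-succ (ℤP.<⇒≤ αj<)
    fromAt : At j i → Before j k
    fromAt (αj , βj) = trans βj (sym βk) , below-succ (ℤP.≤-reflexive αj)
    exclusive : Before j i → At j i → ⊥
    exclusive (_ , αj<) (αj , _) = ℤP.<-irrefl αj αj<

  potential-step : ∀ {i k} → Successor i k → potential k ≡ potential i ℕ.+ 𝟙 (absent? i k)
  potential-step {i} {k} succ = begin
    potential k
      ≡⟨ sum-cong-≗ (λ j → trans (cong (ℕ._* broken j) (before-successor succ j))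
                                  (ℕP.*-distribʳ-+ (broken j) (𝟙 (before? j i)) (𝟙 (at? j i)))) ⟩
    sum (λ j → 𝟙 (before? j i) ℕ.* broken j ℕ.+ 𝟙 (at? j i) ℕ.* broken j)
      ≡⟨ ∑-distrib-+ (λ j → 𝟙 (before? j i) ℕ.* broken j) (λ j → 𝟙 (at? j i) ℕ.* broken j) ⟩
    potential i ℕ.+ sum (λ j → 𝟙 (at? j i) ℕ.* broken j)
      ≡⟨ cong (potential i ℕ.+_) (sum-select (λ j → at? j i) broken i (refl , refl)
                                   λ j (αj , βj) → injective j i αj βj) ⟩
    potential i ℕ.+ broken i
      ≡⟨ cong (potential i ℕ.+_) (broken-at succ) ⟩
    potential i ℕ.+ 𝟙 (absent? i k) ∎
    where open ≡-Reasoning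

-- Size estimates for a coordinate difference of the form c * M + e, where the
-- coarse part c comes from the grid offset and the perturbation e from potentials.
module Estimates where
  open import Data.Integer using (_+_; _-_; _*_)

  spread : ∀ c e M → 5 ℕ.≤ ∣ c ∣ → ∣ e ∣ ℕ.< M → 4 ℕ.* M ℕ.< ∣ c * + M + e ∣
  spread c e M big small = ℕP.+-cancelʳ-< M (4 ℕ.* M) ∣ c * + M + e ∣ (begin-strict
    4 ℕ.* M ℕ.+ M               ≡⟨ ℕP.+-comm (4 ℕ.* M) M ⟩
    5 ℕ.* M                     ≤⟨ ℕP.*-monoˡ-≤ M big ⟩
    ∣ c ∣ ℕ.* M                 ≡⟨ sym (ℤP.∣i*j∣≡∣i∣*∣j∣ c (+ M)) ⟩
    ∣ c * + M ∣                 ≤⟨ ∣i∣≤∣i+j∣+∣j∣ (c * + M) e ⟩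
    ∣ c * + M + e ∣ ℕ.+ ∣ e ∣   <⟨ ℕP.+-monoʳ-< ∣ c * + M + e ∣ small ⟩
    ∣ c * + M + e ∣ ℕ.+ M       ∎)
    where open ℕP.≤-Reasoning

  nearby : ∀ c e M → ∣ c ∣ ℕ.≤ 3 → 2 ℕ.+ ∣ e ∣ ℕ.≤ M → 2 ℕ.+ ∣ c * + M + e ∣ ℕ.≤ 4 ℕ.* M
  nearby c e M small fits = begin
    2 ℕ.+ ∣ c * + M + e ∣            ≤⟨ ℕP.+-monoʳ-≤ 2 (ℤP.∣i+j∣≤∣i∣+∣j∣ (c * + M) e) ⟩
    2 ℕ.+ (∣ c * + M ∣ ℕ.+ ∣ e ∣)    ≡⟨ cong (λ x → 2 ℕ.+ (x ℕ.+ ∣ e ∣)) (ℤP.∣i*j∣≡∣i∣*∣j∣ c (+ M)) ⟩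
    2 ℕ.+ (∣ c ∣ ℕ.* M ℕ.+ ∣ e ∣)    ≤⟨ ℕP.+-monoʳ-≤ 2 (ℕP.+-monoˡ-≤ ∣ e ∣ (ℕP.*-monoˡ-≤ M small)) ⟩
    2 ℕ.+ (3 ℕ.* M ℕ.+ ∣ e ∣)        ≡⟨ swap-front 2 (3 ℕ.* M) ∣ e ∣ ⟩
    3 ℕ.* M ℕ.+ (2 ℕ.+ ∣ e ∣)        ≤⟨ ℕP.+-monoʳ-≤ (3 ℕ.* M) fits ⟩
    3 ℕ.* M ℕ.+ M                    ≡⟨ ℕP.+-comm (3 ℕ.* M) M ⟩
    4 ℕ.* M                          ∎
    where
    open ℕP.≤-Reasoning
    swap-front : ∀ x y z → x ℕ.+ (y ℕ.+ z) ≡ y ℕ.+ (x ℕ.+ z)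
    swap-front x y z = trans (sym (ℕP.+-assoc x y z))
                        (trans (cong (ℕ._+ z) (ℕP.+-comm x y)) (ℕP.+-assoc y x z))

  ∣p-q∣≤ : ∀ {p q N} → p ℕ.≤ N → q ℕ.≤ N → ∣ + p - + q ∣ ℕ.≤ N
  ∣p-q∣≤ {p} {q} p≤ q≤ =
    subst (ℕ._≤ _) (cong ∣_∣ (sym (ℤP.[+m]-[+n]≡m⊖n p q))) (ℕP.≤-trans (ℤP.∣m⊝n∣≤m⊔n p q) (ℕP.⊔-lub p≤ q≤))

open Estimates

module Offsets where
  open import Data.Integer using (_+_; _-_; _*_)
  open import Data.Fin.Properties using (any?)
  open import Relation.Nullary.Decidable using (from-yes; from-no)

  slope : Fin 3 → ℤ → ℤ → ℤ
  slope zero a b = + 4 * a - b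
  slope (suc zero) a b = + 4 * b
  slope (suc (suc zero)) a b = + 3 * (a + b)

  slope-linear : ∀ l a b a′ b′ → slope l a′ b′ - slope l a b ≡ slope l (a′ - a) (b′ - b)
  slope-linear zero = linear
    where
    linear : ∀ a b a′ b′ → + 4 * a′ - b′ - (+ 4 * a - b) ≡ + 4 * (a′ - a) - (b′ - b)
    linear = solve-∀
  slope-linear (suc zero) = linear
    where
    linear : ∀ a b a′ b′ → + 4 * b′ - + 4 * b ≡ + 4 * (b′ - b)
    linear _ = solve-∀
  slope-linear (suc (suc zero)) = linear
    where
    linear : ∀ a b a′ b′ → + 3 * (a′ + b′) - + 3 * (a + b) ≡ + 3 * (a′ - a + (b′ - b))
    linear = solve-∀

  Unit : ℤ → ℤ → Set
  Unit da db = (da ≡ 1ℤ × db ≡ 0ℤ) ⊎ (da ≡ 0ℤ × db ≡ 1ℤ) ⊎ (da ≡ -1ℤ × db ≡ 0ℤ) ⊎ (da ≡ 0ℤ × db ≡ -1ℤ)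

  Far : ℤ → ℤ → Set
  Far da db = Σ (Fin 3) λ l → 5 ℕ.≤ ∣ slope l da db ∣

  far? : ∀ da db → Dec (Far da db)
  far? da db = any? λ l → 5 ℕ.≤? ∣ slope l da db ∣

  unit⇒¬far : ∀ {da db} → Unit da db → ¬ Far da db
  unit⇒¬far (inj₁ (refl , refl)) = from-no (far? 1ℤ 0ℤ)
  unit⇒¬far (inj₂ (inj₁ (refl , refl))) = from-no (far? 0ℤ 1ℤ)
  unit⇒¬far (inj₂ (inj₂ (inj₁ (refl , refl)))) = from-no (far? -1ℤ 0ℤ)
  unit⇒¬far (inj₂ (inj₂ (inj₂ (refl , refl)))) = from-no (far? 0ℤ -1ℤ)

  far-vertical : ∀ da db → 2 ℕ.≤ ∣ db ∣ → Far da db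
  far-vertical da db big = suc zero , ℕP.≤-trans (ℕP.m≤m+n 5 3)
    (subst (8 ℕ.≤_) (sym (ℤP.∣i*j∣≡∣i∣*∣j∣ (+ 4) db)) (ℕP.*-monoʳ-≤ 4 big))

  far-horizontal : ∀ da db → 2 ℕ.≤ ∣ da ∣ → ∣ db ∣ ℕ.< 2 → Far da db
  far-horizontal da db big small = zero , ℕP.≤-trans (ℕP.m≤m+n 5 2)
    (ℕP.+-cancelʳ-≤ 1 7 ∣ + 4 * da - db ∣ (begin
      8                                  ≤⟨ ℕP.*-monoʳ-≤ 4 big ⟩
      4 ℕ.* ∣ da ∣                       ≡⟨ sym (ℤP.∣i*j∣≡∣i∣*∣j∣ (+ 4) da) ⟩
      ∣ + 4 * da ∣                       ≤⟨ ∣i∣≤∣i+j∣+∣j∣ (+ 4 * da) (ℤ.- db) ⟩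
      ∣ + 4 * da - db ∣ ℕ.+ ∣ ℤ.- db ∣    ≤⟨ ℕP.+-monoʳ-≤ ∣ + 4 * da - db ∣
                                              (subst (ℕ._≤ 1) (sym (ℤP.∣-i∣≡∣i∣ db)) (ℕP.≤-pred small)) ⟩
      ∣ + 4 * da - db ∣ ℕ.+ 1            ∎))
    where open ℕP.≤-Reasoning

  Offset : ℤ → ℤ → Set
  Offset da db = (da ≡ 0ℤ × db ≡ 0ℤ) ⊎ Unit da db ⊎ Far da db

  classify-small : ∀ da db → ∣ da ∣ ℕ.< 2 → ∣ db ∣ ℕ.< 2 → Offset da db
  classify-small (+ suc (suc _)) _ (ℕ.s≤s (ℕ.s≤s ())) _
  classify-small -[1+ suc _ ] _ (ℕ.s≤s (ℕ.s≤s ())) _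
  classify-small _ (+ suc (suc _)) _ (ℕ.s≤s (ℕ.s≤s ()))
  classify-small _ -[1+ suc _ ] _ (ℕ.s≤s (ℕ.s≤s ()))
  classify-small (+ 0) (+ 0) _ _ = inj₁ (refl , refl)
  classify-small (+ 1) (+ 0) _ _ = inj₂ (inj₁ (inj₁ (refl , refl)))
  classify-small (+ 0) (+ 1) _ _ = inj₂ (inj₁ (inj₂ (inj₁ (refl , refl))))
  classify-small -[1+ 0 ] (+ 0) _ _ = inj₂ (inj₁ (inj₂ (inj₂ (inj₁ (refl , refl)))))
  classify-small (+ 0) -[1+ 0 ] _ _ = inj₂ (inj₁ (inj₂ (inj₂ (inj₂ (refl , refl)))))
  classify-small (+ 1) (+ 1) _ _ = inj₂ (inj₂ (from-yes (far? 1ℤ 1ℤ)))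
  classify-small (+ 1) -[1+ 0 ] _ _ = inj₂ (inj₂ (from-yes (far? 1ℤ -1ℤ)))
  classify-small -[1+ 0 ] (+ 1) _ _ = inj₂ (inj₂ (from-yes (far? -1ℤ 1ℤ)))
  classify-small -[1+ 0 ] -[1+ 0 ] _ _ = inj₂ (inj₂ (from-yes (far? -1ℤ -1ℤ)))

  classify : ∀ da db → Offset da db
  classify da db with 2 ℕ.≤? ∣ db ∣
  ... | yes big-b = inj₂ (inj₂ (far-vertical da db big-b))
  ... | no small-b with 2 ℕ.≤? ∣ da ∣
  ...   | yes big-a = inj₂ (inj₂ (far-horizontal da db big-a (ℕP.≰⇒> small-b)))
  ...   | no small-a = classify-small da db (ℕP.≰⇒> small-a) (ℕP.≰⇒> small-b)

open Offsets

module SquareGrid (G : FiniteSubgraph SquareAdj) where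
  open FiniteSubgraph G
  open import Data.Integer using (_+_; _-_; _*_)

  a b : Fin n → ℤ
  a i = proj₁ (vertex i)
  b i = proj₂ (vertex i)

  ab-injective : ∀ i j → a i ≡ a j → b i ≡ b j → i ≡ j
  ab-injective i j a≡ b≡ = vertex-inj i j (cong₂ _,_ a≡ b≡)

  module Row = Potential a b ab-injective edge
  module Column = Potential b a (λ i j b≡ a≡ → ab-injective i j a≡ b≡) edge

  N M : ℕ
  N = n ℕ.* n
  M = 2 ℕ.+ N

  open Geometry (ℕ.pred (4 ℕ.* M))

  drift : Fin 3 → Fin n → ℕ
  drift zero = Row.potential
  drift (suc zero) = Column.potential
  drift (suc (suc zero)) _ = 0

  drift-≤ : ∀ l i → drift l i ℕ.≤ N
  drift-≤ zero = Row.potential-≤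
  drift-≤ (suc zero) = Column.potential-≤
  drift-≤ (suc (suc zero)) _ = ℕ.z≤n

  corner : Fin n → Fin 3 → ℤ
  corner i l = slope l (a i) (b i) * + M + + drift l i

  gap : Fin 3 → Fin n → Fin n → ℤ
  gap l i j = + drift l j - + drift l i

  gap-≤ : ∀ l i j → ∣ gap l i j ∣ ℕ.≤ N
  gap-≤ l i j = ∣p-q∣≤ (drift-≤ l j) (drift-≤ l i)

  offset : ∀ {i j da db} l → a j - a i ≡ da → b j - b i ≡ db →
           corner j l - corner i l ≡ slope l da db * + M + gap l i j
  offset {i} {j} l refl refl = trans
    (regroup (slope l (a j) (b j)) (slope l (a i) (b i)) (+ M) (+ drift l j) (+ drift l i))
    (cong (λ s → s * + M + gap l i j) (slope-linear l (a i) (b i) (a j) (b j)))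
    where
    regroup : ∀ s′ s m w′ w → s′ * m + w′ - (s * m + w) ≡ (s′ - s) * m + (w′ - w)
    regroup = solve-∀

  Good : Fin n → Fin n → Set
  Good i j = GoodPair (corner i) (corner j) (edge i j)

  far-good : ∀ {i j} → Far (a j - a i) (b j - b i) → Good i j
  far-good {i} {j} (l , big) = good-apart (corner i) (corner j) l separated (not-true (edge i j) not-edge)
    where
    separated : 4 ℕ.* M ℕ.< ∣ corner j l - corner i l ∣
    separated = subst (λ d → 4 ℕ.* M ℕ.< ∣ d ∣) (sym (offset l refl refl))
      (spread (slope l (a j - a i) (b j - b i)) (gap l i j) M big (ℕ.s≤s (ℕP.m≤n⇒m≤1+n (gap-≤ l i j))))
    grid-unit : SquareAdj (vertex i) (vertex j) → Unit (a j - a i) (b j - b i)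
    grid-unit (inj₁ (inj₁ (a≡ , b≡))) = inj₁ (shift-diff {a i} a≡ , ℤP.i≡j⇒i-j≡0 b≡)
    grid-unit (inj₁ (inj₂ (a≡ , b≡))) = inj₂ (inj₁ (ℤP.i≡j⇒i-j≡0 a≡ , shift-diff {b i} b≡))
    grid-unit (inj₂ (inj₁ (a≡ , b≡))) = inj₂ (inj₂ (inj₁ (back-diff {a i} {a j} a≡ , ℤP.i≡j⇒i-j≡0 (sym b≡))))
    grid-unit (inj₂ (inj₂ (a≡ , b≡))) = inj₂ (inj₂ (inj₂ (ℤP.i≡j⇒i-j≡0 (sym a≡) , back-diff {b i} {b j} b≡)))
    not-edge : edge i j ≢ true
    not-edge e = unit⇒¬far (grid-unit (edge-adj i j e)) (l , big)
    not-true : ∀ e → e ≢ true → e ≡ false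
    not-true true ne = ⊥-elim (ne refl)
    not-true false _ = refl

  normal-offset : ∀ {i j da db δ} k → a j - a i ≡ da → b j - b i ≡ db → slope k da db ≡ + 4 →
                  drift k j ≡ drift k i ℕ.+ δ → corner j k - corner i k ≡ + (4 ℕ.* M ℕ.+ δ)
  normal-offset {i} {j} {da} {db} {δ} k Δa Δb coarse step = begin
    corner j k - corner i k                 ≡⟨ offset k Δa Δb ⟩
    slope k da db * + M + gap k i j          ≡⟨ cong₂ (λ s g → s * + M + g) coarse (cong (_- + drift k i) (cong +_ step)) ⟩
    + 4 * + M + (+ (drift k i ℕ.+ δ) - + drift k i)
                                             ≡⟨ cong (λ g → + 4 * + M + (g - + drift k i)) (ℤP.pos-+ (drift k i) δ) ⟩
    + 4 * + M + (+ drift k i + + δ - + drift k i)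
                                             ≡⟨ cong (λ g → + 4 * + M + g) (add-sub (+ drift k i) (+ δ)) ⟩
    + 4 * + M + + δ                          ≡⟨ cong (_+ + δ) (sym (ℤP.pos-* 4 M)) ⟩
    + (4 ℕ.* M) + + δ                        ≡⟨ sym (ℤP.pos-+ (4 ℕ.* M) δ) ⟩
    + (4 ℕ.* M ℕ.+ δ)                        ∎
    where open ≡-Reasoning

  neighbour-good : ∀ {i j da db} k → a j - a i ≡ da → b j - b i ≡ db →
                   slope k da db ≡ + 4 → (∀ l → l ≢ k → ∣ slope l da db ∣ ℕ.≤ 3) →
                   drift k j ≡ drift k i ℕ.+ 𝟙 (edge i j Data.Bool.≟ false) → Good i j
  neighbour-good {i} {j} {da} {db} k Δa Δb coarse small step with edge i j
  ... | true = good-contact (corner i) (corner j) k (trans (normal-offset k Δa Δb coarse step)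
                                     (cong +_ (ℕP.+-identityʳ (4 ℕ.* M)))) overlaps refl
    where
    overlaps : ∀ l → l ≢ k → 2 ℕ.+ ∣ corner j l - corner i l ∣ ℕ.≤ 4 ℕ.* M
    overlaps l l≢k = subst (λ d → 2 ℕ.+ ∣ d ∣ ℕ.≤ 4 ℕ.* M) (sym (offset l Δa Δb))
      (nearby (slope l da db) (gap l i j) M (small l l≢k) (ℕP.+-monoʳ-≤ 2 (gap-≤ l i j)))
  ... | false = good-apart (corner i) (corner j) k
    (subst (λ d → 4 ℕ.* M ℕ.< ∣ d ∣) (sym (normal-offset k Δa Δb coarse step))
      (ℕP.m<m+n (4 ℕ.* M) (ℕ.s≤s ℕ.z≤n))) refl

  right-good : ∀ {i j} → a j - a i ≡ 1ℤ → b j - b i ≡ 0ℤ → Good i j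
  right-good {i} {j} Δa Δb = neighbour-good zero Δa Δb refl small
    (Row.potential-step (i-j≡k⇒i≡j+k Δa , trans (i-j≡k⇒i≡j+k Δb) (ℤP.+-identityʳ (b i))))
    where
    small : ∀ l → l ≢ zero → ∣ slope l 1ℤ 0ℤ ∣ ℕ.≤ 3
    small zero l≢k = ⊥-elim (l≢k refl)
    small (suc zero) _ = ℕ.z≤n
    small (suc (suc zero)) _ = ℕP.≤-refl

  up-good : ∀ {i j} → a j - a i ≡ 0ℤ → b j - b i ≡ 1ℤ → Good i j
  up-good {i} {j} Δa Δb = neighbour-good (suc zero) Δa Δb refl small
    (Column.potential-step (i-j≡k⇒i≡j+k Δb , trans (i-j≡k⇒i≡j+k Δa) (ℤP.+-identityʳ (a i))))
    where
    small : ∀ l → l ≢ suc zero → ∣ slope l 0ℤ 1ℤ ∣ ℕ.≤ 3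
    small zero _ = ℕ.s≤s ℕ.z≤n
    small (suc zero) l≢k = ⊥-elim (l≢k refl)
    small (suc (suc zero)) _ = ℕP.≤-refl

  mirror : ∀ {i j} → Good j i → Good i j
  mirror {i} {j} good = subst (GoodPair (corner i) (corner j)) (edge-sym j i) (good-mirror (corner i) (corner j) good)

  good : ∀ i j → i ≢ j → Good i j
  good i j i≢j with classify (a j - a i) (b j - b i)
  ... | inj₁ (Δa , Δb) = ⊥-elim (i≢j (sym (ab-injective j i (ℤP.i-j≡0⇒i≡j _ _ Δa) (ℤP.i-j≡0⇒i≡j _ _ Δb))))
  ... | inj₂ (inj₁ (inj₁ (Δa , Δb))) = right-good Δa Δb
  ... | inj₂ (inj₁ (inj₂ (inj₁ (Δa , Δb)))) = up-good Δa Δb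
  ... | inj₂ (inj₁ (inj₂ (inj₂ (inj₁ (Δa , Δb))))) = mirror (right-good (flip-diff {a i} Δa) (flip-diff {b i} Δb))
  ... | inj₂ (inj₁ (inj₂ (inj₂ (inj₂ (Δa , Δb))))) = mirror (up-good (flip-diff {a i} Δa) (flip-diff {b i} Δb))
  ... | inj₂ (inj₂ far) = far-good far

  representation : HasUnitCubeContactRep G
  representation = (λ i → pt (corner i)) , (λ i j i≢j → proj₁ (good i j i≢j)) , (λ i j i≢j → proj₂ (good i j i≢j))

module Transfer {V W : Set} {Adj : V → V → Set} {Adj′ : W → W → Set}
                (φ : V → W) (φ-injective : ∀ u v → φ u ≡ φ v → u ≡ v)
                (φ-adjacent : ∀ u v → Adj u v → Adj′ (φ u) (φ v)) where

  embed : FiniteSubgraph Adj → FiniteSubgraph Adj′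
  embed G = record
    { n = n ; vertex = φ ∘ vertex
    ; vertex-inj = λ i j e → vertex-inj i j (φ-injective _ _ e)
    ; edge = edge ; edge-sym = edge-sym
    ; edge-adj = λ i j e → φ-adjacent _ _ (edge-adj i j e) }
    where open FiniteSubgraph G

  transfer : ((G′ : FiniteSubgraph Adj′) → HasUnitCubeContactRep G′) →
             (G : FiniteSubgraph Adj) → HasUnitCubeContactRep G
  transfer represent G = represent (embed G)

hex⇒square : ∀ u v → HexAdj u v → SquareAdj u v
hex⇒square u v = Data.Sum.map (Data.Sum.map₂ proj₁) (Data.Sum.map₂ proj₁)

-- Cells then sit on the index-5 lattice spanned by (2, -1) and (1, 2), so
-- neighbouring cells are joined by unit steps and distinct corners never meet.
module OctagonalSquare where
  open import Data.Integer using (_+_; _-_; _*_; -_)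
  open import Data.Fin.Properties using (all?)
  open import Relation.Nullary.Decidable using (from-yes; _→-dec_)

  cx cy : Fin 4 → ℤ
  cx zero = 1ℤ
  cx (suc zero) = 1ℤ
  cx (suc (suc zero)) = 0ℤ
  cx (suc (suc (suc zero))) = 0ℤ
  cy zero = 0ℤ
  cy (suc zero) = 1ℤ
  cy (suc (suc zero)) = 1ℤ
  cy (suc (suc (suc zero))) = 0ℤ

  φ : ℤ × ℤ × Fin 4 → ℤ × ℤ
  φ (a , b , i) = + 2 * a + b + cx i , - a + + 2 * b + cy i

  -- The coarse offset between cells, as seen through two corner offsets;
  -- five times the cell difference equals it when the images coincide.
  K L : Fin 4 → Fin 4 → ℤ
  K i j = + 2 * (cx j - cx i) - (cy j - cy i)
  L i j = (cx j - cx i) + + 2 * (cy j - cy i)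

  K-small : ∀ i j → ∣ K i j ∣ ℕ.< 5
  K-small = from-yes (all? λ i → all? λ j → ∣ K i j ∣ ℕ.<? 5)

  L-small : ∀ i j → ∣ L i j ∣ ℕ.< 5
  L-small = from-yes (all? λ i → all? λ j → ∣ L i j ∣ ℕ.<? 5)

  corners-distinct : ∀ i j → K i j ≡ 0ℤ → L i j ≡ 0ℤ → i ≡ j
  corners-distinct = from-yes (all? λ i → all? λ j →
    (K i j ℤ.≟ 0ℤ) →-dec (L i j ℤ.≟ 0ℤ) →-dec (i Fin.≟ j))

  small-multiple : ∀ x k → + 5 * x ≡ k → ∣ k ∣ ℕ.< 5 → x ≡ 0ℤ
  small-multiple x k refl small = ℤP.∣i∣≡0⇒i≡0 (ℕP.n<1⇒n≡0
    (ℕP.*-cancelˡ-< 5 ∣ x ∣ 1 (subst (ℕ._< 5) (ℤP.∣i*j∣≡∣i∣*∣j∣ (+ 5) x) small)))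

  -- φ is injective: equal images force 5 (a - c) and 5 (b - d) to be small, hence 0.
  φ-injective : ∀ u v → φ u ≡ φ v → u ≡ v
  φ-injective (a , b , i) (c , d , j) eq =
    cong₂ _,_ (ℤP.i-j≡0⇒i≡j a c a≡) (cong₂ _,_ (ℤP.i-j≡0⇒i≡j b d b≡) (corners-distinct i j K≡0 L≡0))
    where
    X≡ : (+ 2 * a + b + cx i) - (+ 2 * c + d + cx j) ≡ 0ℤ
    X≡ = ℤP.i≡j⇒i-j≡0 (cong proj₁ eq)
    Y≡ : (- a + + 2 * b + cy i) - (- c + + 2 * d + cy j) ≡ 0ℤ
    Y≡ = ℤP.i≡j⇒i-j≡0 (cong proj₂ eq)
    solve-a : ∀ a b c d p q p′ q′ → + 5 * (a - c) ≡
      + 2 * ((+ 2 * a + b + p) - (+ 2 * c + d + p′)) - ((- a + + 2 * b + q) - (- c + + 2 * d + q′))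
      + (+ 2 * (p′ - p) - (q′ - q))
    solve-a = solve-∀
    solve-b : ∀ a b c d p q p′ q′ → + 5 * (b - d) ≡
      ((+ 2 * a + b + p) - (+ 2 * c + d + p′)) + + 2 * ((- a + + 2 * b + q) - (- c + + 2 * d + q′))
      + ((p′ - p) + + 2 * (q′ - q))
    solve-b = solve-∀
    5a : + 5 * (a - c) ≡ K i j
    5a = trans (solve-a a b c d (cx i) (cy i) (cx j) (cy j))
               (trans (cong₂ (λ x y → + 2 * x - y + K i j) X≡ Y≡) (ℤP.+-identityˡ (K i j)))
    5b : + 5 * (b - d) ≡ L i j
    5b = trans (solve-b a b c d (cx i) (cy i) (cx j) (cy j))
               (trans (cong₂ (λ x y → x + + 2 * y + L i j) X≡ Y≡) (ℤP.+-identityˡ (L i j)))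
    a≡ : a - c ≡ 0ℤ
    a≡ = small-multiple (a - c) (K i j) 5a (K-small i j)
    b≡ : b - d ≡ 0ℤ
    b≡ = small-multiple (b - d) (L i j) 5b (L-small i j)
    K≡0 : K i j ≡ 0ℤ
    K≡0 = trans (sym 5a) (cong (+ 5 *_) a≡)
    L≡0 : L i j ≡ 0ℤ
    L≡0 = trans (sym 5b) (cong (+ 5 *_) b≡)

  plus-one : ∀ z → z + 1ℤ ≡ z + 0ℤ + 1ℤ
  plus-one = solve-∀

  east-x : ∀ a b → + 2 * (a + 1ℤ) + b + 0ℤ ≡ + 2 * a + b + 1ℤ + 1ℤ
  east-x = solve-∀

  east-y : ∀ a b → - (a + 1ℤ) + + 2 * b + 1ℤ ≡ - a + + 2 * b + 0ℤ
  east-y = solve-∀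

  north-x : ∀ a b → + 2 * a + (b + 1ℤ) + 0ℤ ≡ + 2 * a + b + 1ℤ
  north-x = solve-∀

  north-y : ∀ a b → - a + + 2 * (b + 1ℤ) + 0ℤ ≡ - a + + 2 * b + 1ℤ + 1ℤ
  north-y = solve-∀

  φ-step : ∀ u v → OctStep u v → SquareAdj (φ u) (φ v)
  φ-step (a , b , zero) _ (inj₁ (refl , refl , refl)) = inj₁ (inj₂ (refl , plus-one (- a + + 2 * b)))
  φ-step (a , b , suc zero) _ (inj₁ (refl , refl , refl)) = inj₂ (inj₁ (plus-one (+ 2 * a + b) , refl))
  φ-step (a , b , suc (suc zero)) _ (inj₁ (refl , refl , refl)) = inj₂ (inj₂ (refl , plus-one (- a + + 2 * b)))
  φ-step (a , b , suc (suc (suc zero))) _ (inj₁ (refl , refl , refl)) = inj₁ (inj₁ (plus-one (+ 2 * a + b) , refl))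
  φ-step (a , b , _) _ (inj₂ (inj₁ (refl , refl , refl , refl))) = inj₁ (inj₁ (east-x a b , east-y a b))
  φ-step (a , b , _) _ (inj₂ (inj₂ (refl , refl , refl , refl))) = inj₁ (inj₂ (north-x a b , north-y a b))

  φ-adjacent : ∀ u v → OctSqAdj u v → SquareAdj (φ u) (φ v)
  φ-adjacent u v (inj₁ step) = φ-step u v step
  φ-adjacent u v (inj₂ step) = Data.Sum.swap (φ-step v u step)

theorem4 : ((G : FiniteSubgraph SquareAdj) → HasUnitCubeContactRep G)
         × ((G : FiniteSubgraph HexAdj) → HasUnitCubeContactRep G)
         × ((G : FiniteSubgraph OctSqAdj) → HasUnitCubeContactRep G)
theorem4 = square
         , Transfer.transfer (λ v → v) (λ _ _ eq → eq) hex⇒square square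
         , Transfer.transfer OctagonalSquare.φ OctagonalSquare.φ-injective OctagonalSquare.φ-adjacent square
  where
  square : (G : FiniteSubgraph SquareAdj) → HasUnitCubeContactRep G
  square = SquareGrid.representation
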